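{- Let $r_i\geq 0$, $1\leq i\leq k$, be integers such that $\sum^k_{i=1}r_i=n$. A permutation $\pi \in \mathbf{S}_n$ is the suffix array of a word $w\in \Sigma^n$ with $r_i$ occurrences of the letter $a_i$, $1 \leq i \leq k$, if and only if, for $\pi'=(n+1)\, \pi(1)\dots \pi(n)\in\mathbf{S}_{n+1}$, $\{\,i\in[1,n] : \Phi(\pi')(i)>\Phi(\pi')(i+1)\,\}\subseteq\{1,1+r_1,1+r_1+r_2,\dots, 1+r_1+\dots +r_{k-1} \}$. Moreover, in this case $\pi$ is the suffix array of exactly one such word.
   Context: $\Sigma=\{a_1<a_2<\dots<a_k\}$ is an ordered alphabet. $\mathbf{S}_m$ is the set of permutations of $[1,m]$. The suffix array of a word $u=u_1\dots u_m$ is the permutation $\pi$ with $\pi(i)=j$ iff $u_j\dots u_m$ is the $i$-th suffix of $u$ in lexicographic order. For $\sigma\in\mathbf{S}_m$ the linking permutation is $\Phi(\sigma)=\sigma^{ -1}(\sigma+1)$, i.e. $\Phi(\sigma)(i)=\sigma^{ -1}(\sigma(i)+1)$ where values are taken cyclically ($m+1\equiv 1$). -}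

module Defs where

open import Data.Nat using (ℕ; zero; suc; _+_; s≤s)
open import Data.Nat.Properties using (_<?_)
open import Data.Fin using (Fin; zero; suc; toℕ; fromℕ; fromℕ<; inject₁; _<_)
open import Data.Fin.Permutation using (Permutation′; insert; _⟨$⟩ʳ_; _⟨$⟩ˡ_)
open import Data.Vec using (Vec; toList; count)
open import Data.List using (List; drop)
open import Data.List.Relation.Binary.Lex.Strict using (Lex-<)
open import Data.Product using (∃; _×_)
open import Relation.Binary.PropositionalEquality using (_≡_)
open import Relation.Nullary using (yes; no)
import Data.Fin.Properties as FinP

-- Alphabet Σ = {a₁ < … < a_k} is modelled by Fin k with its natural order
-- (letter a_{i+1} ↔ (i : Fin k)).
-- Positions are 0-indexed: position p : Fin n corresponds to p+1 in the paper.

suffix : ∀ {k m} → Vec (Fin k) m → Fin m → List (Fin k)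
suffix u j = drop (toℕ j) (toList u)

_<lex_ : ∀ {k} → List (Fin k) → List (Fin k) → Set
_<lex_ = Lex-< _≡_ _<_

IsSuffixArray : ∀ {k m} → Vec (Fin k) m → Permutation′ m → Set
IsSuffixArray {m = m} u π =
  ∀ (i j : Fin m) → i < j → suffix u (π ⟨$⟩ʳ i) <lex suffix u (π ⟨$⟩ʳ j)

occ : ∀ {k m} → Vec (Fin k) m → Fin k → ℕ
occ u a = count (FinP._≟ a) u

HasContent : ∀ {k m} → (Fin k → ℕ) → Vec (Fin k) m → Set
HasContent r u = ∀ a → occ u a ≡ r a

prefixSum : ∀ {k} → (Fin k → ℕ) → Fin (suc k) → ℕ
prefixSum r zero = 0
prefixSum {suc k} r (suc j) = r zero + prefixSum (λ l → r (suc l)) j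

total : ∀ {k} → (Fin k → ℕ) → ℕ
total {k} r = prefixSum r (fromℕ k)

-- Cyclic successor on Fin (suc m) (the last element wraps to zero),
-- i.e. x ↦ x + 1 with m+1 ≡ 1 in the paper's 1-indexed notation.
csuc : ∀ {m} → Fin (suc m) → Fin (suc m)
csuc {m} i with toℕ i <? m
... | yes p = fromℕ< (s≤s p)
... | no _ = zero

Φ : ∀ {m} → Permutation′ (suc m) → Fin (suc m) → Fin (suc m)
Φ σ i = σ ⟨$⟩ˡ csuc (σ ⟨$⟩ʳ i)

-- π' = (n+1) π(1) … π(n) ∈ S_{n+1}: position 0 ↦ the largest value,
-- position suc i ↦ π(i) (insert maps suc i to punchIn last (π i) = inject₁ (π i)).
extend : ∀ {n} → Permutation′ n → Permutation′ (suc n)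
extend {n} π = insert zero (fromℕ n) π

-- Every descent position i ∈ [1,n] of Φ(π') (paper, 1-indexed; here i : Fin n
-- stands for paper-position toℕ i + 1, compared with its successor) lies in
-- {1, 1+r₁, 1+r₁+r₂, …, 1+r₁+…+r_{k-1}}, i.e. toℕ i = r₁+…+r_j for some j < k.
DescentsAllowed : ∀ {k n} → (Fin k → ℕ) → Permutation′ n → Set
DescentsAllowed {k} {n} r π =
  ∀ (i : Fin n) → Φ (extend π) (suc i) < Φ (extend π) (inject₁ i) →
    ∃ λ (j : Fin k) → toℕ i ≡ prefixSum r (inject₁ j)

-- For x < n, Φ(π')(x+1) is 0 when the x-th smallest suffix has length one, and otherwise 1 + the
-- rank of that suffix with its first letter removed; so two suffixes with the same first letter
-- are ordered as their values under Φ(π'). If w has content r and suffix array π, the first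
-- letters of its suffixes, taken in increasing order, spell the sorted word a₁^r₁ … a_k^r_k,
-- which changes letter exactly at the prefix sums of r; inside a block of equal letters Φ(π')
-- must increase, so every descent sits at a block boundary. Conversely, if it does, the word
-- whose x-th smallest suffix starts with the x-th letter of the sorted word has suffix array π,
-- by induction on the length of the suffixes: suffixes in different blocks are ordered by their
-- first letters, and inside a block Φ(π') increases, so their tails are already ordered. Since
-- the first letters are forced, this word is the only one.
module Submission where

open import Defs
open import Data.Nat as ℕ using (ℕ; zero; suc; _+_; _∸_; z≤n; s≤s)
open import Data.Nat.Properties as ℕP using (_<?_)
open import Data.Fin as F using (Fin; zero; suc; toℕ; fromℕ; inject₁; punchIn)
open import Data.Fin.Properties as FP using (toℕ-inject₁; toℕ-fromℕ; toℕ-fromℕ<; toℕ<n; toℕ-injective)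
open import Data.Fin.Induction using (<-weakInduction)
open import Data.Fin.Permutation using (Permutation′; _⟨$⟩ʳ_; _⟨$⟩ˡ_; inverseˡ; inverseʳ; insert-punchIn)
open import Data.Vec using (Vec; toList; lookup; tabulate; _∷_; [])
open import Data.Vec.Properties using (length-toList; lookup∘tabulate; tabulate∘lookup; tabulate-cong)
open import Data.List using (List; drop; _∷_; [])
open import Data.List.Properties using (drop-all)
open import Data.List.Relation.Binary.Lex.Core using (halt; this; next)
open import Data.List.Relation.Binary.Lex.Strict using (<-asymmetric)
open import Algebra.Properties.CommutativeMonoid.Sum ℕP.+-0-commutativeMonoid
  using (sum; sum-permute; ∑-distrib-+; sum-cong-≗; sum-replicate-zero)
open import Data.Product using (∃; _×_; _,_)
open import Data.Sum using (_⊎_; inj₁; inj₂)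
open import Function using (_∘_)
open import Function.Bundles using (_⇔_; mk⇔; Equivalence)
open import Relation.Binary.PropositionalEquality
open import Relation.Nullary using (Dec; yes; no; ¬_; contradiction)
open import Relation.Unary using (Decidable)
open import Relation.Binary.Definitions using (Transitive; tri<; tri≈; tri>)

open Equivalence using (to; from)
import Function.Properties.Equivalence as ⇔

⟨$⟩ʳ-injective : ∀ {n} (π : Permutation′ n) {x y : Fin n} → π ⟨$⟩ʳ x ≡ π ⟨$⟩ʳ y → x ≡ y
⟨$⟩ʳ-injective π {x} {y} e = trans (sym (inverseˡ π)) (trans (cong (π ⟨$⟩ˡ_) e) (inverseˡ π))

≤⇒<∨≡ : ∀ {n} {a b : Fin n} → a F.≤ b → a F.< b ⊎ a ≡ b
≤⇒<∨≡ a≤b with ℕP.m≤n⇒m<n∨m≡n a≤b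
... | inj₁ lt = inj₁ lt
... | inj₂ e = inj₂ (toℕ-injective e)

≺-from-steps : ∀ {n} {A : Set} (_≺_ : A → A → Set) → Transitive _≺_ → (f : Fin n → A) {i j : Fin n} →
  i F.< j → (∀ {a b} → toℕ b ≡ suc (toℕ a) → i F.≤ a → b F.≤ j → f a ≺ f b) → f i ≺ f j
≺-from-steps _≺_ ≺-trans f {zero} {suc zero} _ step = step {zero} {suc zero} refl z≤n ℕP.≤-refl
≺-from-steps _≺_ ≺-trans f {zero} {suc (suc j)} _ step =
  ≺-trans (step {zero} {suc zero} refl z≤n (s≤s z≤n))
          (≺-from-steps _≺_ ≺-trans (f ∘ suc) {zero} {suc j} (s≤s z≤n)
            (λ e _ le → step (cong suc e) z≤n (s≤s le)))
≺-from-steps _≺_ ≺-trans f {suc i} {suc j} (s≤s i<j) step =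
  ≺-from-steps _≺_ ≺-trans (f ∘ suc) i<j (λ e le le′ → step (cong suc e) (s≤s le) (s≤s le′))

indicator : ∀ {P : Set} → Dec P → ℕ
indicator (yes _) = 1
indicator (no _) = 0

indicator-cong : ∀ {P Q : Set} (P? : Dec P) (Q? : Dec Q) → P ⇔ Q → indicator P? ≡ indicator Q?
indicator-cong (yes _) (yes _) _ = refl
indicator-cong (no _) (no _) _ = refl
indicator-cong (yes p) (no ¬q) P⇔Q = contradiction (to P⇔Q p) ¬q
indicator-cong (no ¬p) (yes q) P⇔Q = contradiction (from P⇔Q q) ¬p

indicator-⊎ : ∀ {P Q R : Set} (P? : Dec P) (Q? : Dec Q) (R? : Dec R) → P ⇔ (Q ⊎ R) → ¬ (Q × R) →
  indicator P? ≡ indicator Q? + indicator R?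
indicator-⊎ P? (yes q) (yes r) _ disjoint = contradiction (q , r) disjoint
indicator-⊎ (yes _) (yes _) (no _) _ _ = refl
indicator-⊎ (yes _) (no _) (yes _) _ _ = refl
indicator-⊎ (yes p) (no ¬q) (no ¬r) P⇔Q⊎R _ with to P⇔Q⊎R p
... | inj₁ q = contradiction q ¬q
... | inj₂ r = contradiction r ¬r
indicator-⊎ (no ¬p) (yes q) (no _) P⇔Q⊎R _ = contradiction (from P⇔Q⊎R (inj₁ q)) ¬p
indicator-⊎ (no ¬p) (no _) (yes r) P⇔Q⊎R _ = contradiction (from P⇔Q⊎R (inj₂ r)) ¬p
indicator-⊎ (no _) (no _) (no _) _ _ = refl

count : ∀ {n} {P : Fin n → Set} → Decidable P → ℕ
count P? = sum (λ x → indicator (P? x))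

count-cong : ∀ {n} {P Q : Fin n → Set} (P? : Decidable P) (Q? : Decidable Q) →
  (∀ x → P x ⇔ Q x) → count P? ≡ count Q?
count-cong P? Q? P⇔Q = sum-cong-≗ (λ x → indicator-cong (P? x) (Q? x) (P⇔Q x))

count-permute : ∀ {n} {P : Fin n → Set} (P? : Decidable P) (π : Permutation′ n) →
  count P? ≡ count (P? ∘ (π ⟨$⟩ʳ_))
count-permute P? π = sum-permute (λ x → indicator (P? x)) π

count-toℕ< : ∀ {n} m → m ℕ.≤ n → count (λ (x : Fin n) → toℕ x <? m) ≡ m
count-toℕ< {zero} zero z≤n = refl
count-toℕ< {suc n} zero _ = sum-replicate-zero (suc n)
count-toℕ< {suc n} (suc m) (s≤s m≤n) = cong suc (trans
  (count-cong {n} (λ x → suc (toℕ x) <? suc m) (λ x → toℕ x <? m) (λ _ → mk⇔ ℕ.s<s⁻¹ s≤s))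
  (count-toℕ< {n} m m≤n))

count-down-closed : ∀ {n} {P : Fin n → Set} (P? : Decidable P) → (∀ {x y} → x F.≤ y → P y → P x) →
  ∀ x → P x ⇔ toℕ x ℕ.< count P?
count-down-closed {suc n} {P} P? down x with P? zero
... | yes P0 = shifted x
  where
  shifted : ∀ x → P x ⇔ toℕ x ℕ.< suc (count (P? ∘ suc))
  shifted zero = mk⇔ (λ _ → s≤s z≤n) (λ _ → P0)
  shifted (suc y) = mk⇔ (s≤s ∘ to rest) (from rest ∘ ℕP.≤-pred)
    where rest = count-down-closed (P? ∘ suc) (down ∘ s≤s) y
... | no ¬P0 = mk⇔ (λ Px → contradiction (down z≤n Px) ¬P0)
                   (λ x<0 → contradiction (subst (toℕ x ℕ.<_) none x<0) ℕP.n≮0)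
  where
  none : count (P? ∘ suc) ≡ 0
  none = trans (count-cong (P? ∘ suc) (λ y → toℕ y <? 0)
                  (λ y → mk⇔ (λ Py → contradiction (down z≤n Py) ¬P0) λ ()))
               (count-toℕ< {n} 0 z≤n)

occ≡count : ∀ {k m} (w : Vec (Fin k) m) a → occ w a ≡ count (λ p → lookup w p FP.≟ a)
occ≡count [] a = refl
occ≡count (x ∷ xs) a with x FP.≟ a
... | yes _ = cong suc (occ≡count xs a)
... | no _ = occ≡count xs a

prefixSum-suc : ∀ {k} (r : Fin k → ℕ) (a : Fin k) → prefixSum r (suc a) ≡ prefixSum r (inject₁ a) + r a
prefixSum-suc {suc k} r zero = ℕP.+-identityʳ (r zero)
prefixSum-suc {suc k} r (suc a) =
  trans (cong (r zero +_) (prefixSum-suc (r ∘ suc) a)) (sym (ℕP.+-assoc (r zero) _ _))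

prefixSum≤total : ∀ {k} (r : Fin k → ℕ) (c : Fin (suc k)) → prefixSum r c ℕ.≤ total r
prefixSum≤total r zero = z≤n
prefixSum≤total {suc k} r (suc c) = ℕP.+-monoʳ-≤ (r zero) (prefixSum≤total (r ∘ suc) c)

<+⇔∸< : ∀ {x a b} → a ℕ.≤ x → x ℕ.< a + b ⇔ x ∸ a ℕ.< b
<+⇔∸< {x} {a} {b} a≤x = mk⇔
  (λ lt → ℕP.+-cancelˡ-< a _ _ (subst (ℕ._< a + b) (sym a+[x∸a]≡x) lt))
  (λ lt → subst (ℕ._< a + b) a+[x∸a]≡x (ℕP.+-monoʳ-< a lt))
  where a+[x∸a]≡x = ℕP.m+[n∸m]≡n a≤x

blockOf : ∀ {k} (r : Fin k → ℕ) (x : ℕ) → x ℕ.< total r → Fin k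
blockOf {zero} r x ()
blockOf {suc k} r x x<total with x <? r zero
... | yes _ = zero
... | no x≮r₀ = suc (blockOf (r ∘ suc) (x ∸ r zero) (to (<+⇔∸< (ℕP.≮⇒≥ x≮r₀)) x<total))

blockOf-< : ∀ {k} (r : Fin k → ℕ) x (x<total : x ℕ.< total r) (c : Fin (suc k)) →
  toℕ (blockOf r x x<total) ℕ.< toℕ c ⇔ x ℕ.< prefixSum r c
blockOf-< {zero} r x () c
blockOf-< {suc k} r x x<total zero = mk⇔ (λ ()) (λ ())
blockOf-< {suc k} r x x<total (suc c) with x <? r zero
... | yes x<r₀ = mk⇔ (λ _ → ℕP.<-≤-trans x<r₀ (ℕP.m≤m+n _ _)) (λ _ → s≤s z≤n)
... | no x≮r₀ = mk⇔ (λ { (s≤s lt) → from shift (to rest lt) }) (λ lt → s≤s (from rest (to shift lt)))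
  where
  shift = <+⇔∸< {b = prefixSum (r ∘ suc) c} (ℕP.≮⇒≥ x≮r₀)
  rest = blockOf-< (r ∘ suc) (x ∸ r zero) (to (<+⇔∸< (ℕP.≮⇒≥ x≮r₀)) x<total) c

≡-from-cuts : ∀ {k} {a b : Fin k} →
  (∀ (c : Fin (suc k)) → toℕ a ℕ.< toℕ c ⇔ toℕ b ℕ.< toℕ c) → a ≡ b
≡-from-cuts {a = a} {b} cuts = toℕ-injective (ℕP.≤-antisym
  (ℕP.≤-pred (from (cuts (suc b)) ℕP.≤-refl)) (ℕP.≤-pred (to (cuts (suc a)) ℕP.≤-refl)))

0≡prefixSum : ∀ {k} (r : Fin k → ℕ) → Fin k → ∃ λ j → 0 ≡ prefixSum r (inject₁ j)
0≡prefixSum {suc k} r _ = zero , refl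

module LetterCounts {k n : ℕ} (s : Fin n → Fin k) where

  countBelow : Fin (suc k) → ℕ
  countBelow c = count (λ x → toℕ (s x) <? toℕ c)

  countOf : Fin k → ℕ
  countOf a = count (λ x → s x FP.≟ a)

  countBelow-suc : ∀ a → countBelow (suc a) ≡ countBelow (inject₁ a) + countOf a
  countBelow-suc a = trans
    (sum-cong-≗ (λ x → indicator-⊎ (toℕ (s x) <? suc (toℕ a)) (toℕ (s x) <? toℕ (inject₁ a)) (s x FP.≟ a)
                         <suc⇔<inject₁⊎≡ λ { (lt , refl) → ℕP.<-irrefl (sym (toℕ-inject₁ (s x))) lt }))
    (∑-distrib-+ {n} _ _)
    where
    <suc⇔<inject₁⊎≡ : ∀ {b} → toℕ b ℕ.< suc (toℕ a) ⇔ (toℕ b ℕ.< toℕ (inject₁ a) ⊎ b ≡ a)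
    <suc⇔<inject₁⊎≡ {b} = mk⇔ split join
      where
      split : toℕ b ℕ.< suc (toℕ a) → toℕ b ℕ.< toℕ (inject₁ a) ⊎ b ≡ a
      split (s≤s b≤a) with ℕP.m≤n⇒m<n∨m≡n b≤a
      ... | inj₁ b<a = inj₁ (subst (toℕ b ℕ.<_) (sym (toℕ-inject₁ a)) b<a)
      ... | inj₂ b≡a = inj₂ (toℕ-injective b≡a)
      join : toℕ b ℕ.< toℕ (inject₁ a) ⊎ b ≡ a → toℕ b ℕ.< suc (toℕ a)
      join (inj₁ b<a) = ℕP.m<n⇒m<1+n (subst (toℕ b ℕ.<_) (toℕ-inject₁ a) b<a)
      join (inj₂ refl) = ℕP.≤-refl

  countOf⇔countBelow : (r : Fin k → ℕ) →
    (∀ a → countOf a ≡ r a) ⇔ (∀ c → countBelow c ≡ prefixSum r c)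
  countOf⇔countBelow r = mk⇔ below of
    where
    below : (∀ a → countOf a ≡ r a) → ∀ c → countBelow c ≡ prefixSum r c
    below counts = <-weakInduction (λ c → countBelow c ≡ prefixSum r c) (sum-replicate-zero n) λ a ih → begin
      countBelow (suc a)                   ≡⟨ countBelow-suc a ⟩
      countBelow (inject₁ a) + countOf a   ≡⟨ cong₂ _+_ ih (counts a) ⟩
      prefixSum r (inject₁ a) + r a        ≡⟨ prefixSum-suc r a ⟨
      prefixSum r (suc a)                  ∎
      where open ≡-Reasoning
    of : (∀ c → countBelow c ≡ prefixSum r c) → ∀ a → countOf a ≡ r a
    of counts a = ℕP.+-cancelˡ-≡ (prefixSum r (inject₁ a)) _ _ (begin
      prefixSum r (inject₁ a) + countOf a  ≡⟨ cong (_+ countOf a) (counts (inject₁ a)) ⟨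
      countBelow (inject₁ a) + countOf a   ≡⟨ countBelow-suc a ⟨
      countBelow (suc a)                   ≡⟨ counts (suc a) ⟩
      prefixSum r (suc a)                  ≡⟨ prefixSum-suc r a ⟩
      prefixSum r (inject₁ a) + r a        ∎)
      where open ≡-Reasoning

module SortedWord {k n : ℕ} (r : Fin k → ℕ) (total≡n : total r ≡ n) where

  sortedLetter : Fin n → Fin k
  sortedLetter x = blockOf r (toℕ x) (subst (toℕ x ℕ.<_) (sym total≡n) (toℕ<n x))

  sortedLetter-< : ∀ x c → toℕ (sortedLetter x) ℕ.< toℕ c ⇔ toℕ x ℕ.< prefixSum r c
  sortedLetter-< x = blockOf-< r (toℕ x) _

  sortedLetter-mono : ∀ {x y} → x F.≤ y → sortedLetter x F.≤ sortedLetter y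
  sortedLetter-mono {x} {y} x≤y = ℕP.≤-pred (from (sortedLetter-< x c)
    (ℕP.≤-<-trans x≤y (to (sortedLetter-< y c) ℕP.≤-refl)))
    where c = suc (sortedLetter y)

  boundary⇒sortedLetter-changes : ∀ {a b} c → toℕ b ≡ suc (toℕ a) → toℕ b ≡ prefixSum r c →
    sortedLetter a ≢ sortedLetter b
  boundary⇒sortedLetter-changes {a} {b} c step boundary same = ℕP.<-irrefl boundary
    (to (sortedLetter-< b c) (subst (λ z → toℕ z ℕ.< toℕ c) same
      (from (sortedLetter-< a c) (ℕP.≤-reflexive (trans (sym step) boundary)))))

  sortedLetter-changes⇒boundary : ∀ {a b} → toℕ b ≡ suc (toℕ a) → sortedLetter a ≢ sortedLetter b →
    toℕ b ≡ prefixSum r (inject₁ (sortedLetter b))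
  sortedLetter-changes⇒boundary {a} {b} step changes = ℕP.≤-antisym before after
    where
    c = inject₁ (sortedLetter b)
    before : toℕ b ℕ.≤ prefixSum r c
    before = subst (ℕ._≤ prefixSum r c) (sym step)
      (to (sortedLetter-< a c) (subst (toℕ (sortedLetter a) ℕ.<_) (sym (toℕ-inject₁ (sortedLetter b)))
        (FP.≤∧≢⇒< (sortedLetter-mono (ℕP.<⇒≤ (ℕP.≤-reflexive (sym step)))) changes)))
    after : prefixSum r c ℕ.≤ toℕ b
    after = ℕP.≮⇒≥ (ℕP.<-irrefl (sym (toℕ-inject₁ (sortedLetter b))) ∘ from (sortedLetter-< b c))

  count-sortedLetter : ∀ a → count (λ x → sortedLetter x FP.≟ a) ≡ r a
  count-sortedLetter = from (countOf⇔countBelow r) λ c → trans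
    (count-cong (λ x → toℕ (sortedLetter x) <? toℕ c) (λ x → toℕ x <? prefixSum r c)
                (λ x → sortedLetter-< x c))
    (count-toℕ< (prefixSum r c) (subst (prefixSum r c ℕ.≤_) total≡n (prefixSum≤total r c)))
    where open LetterCounts sortedLetter

  monotone⇒≡sortedLetter : (s : Fin n → Fin k) → (∀ {x y} → x F.≤ y → s x F.≤ s y) →
    (∀ a → count (λ x → s x FP.≟ a) ≡ r a) → ∀ x → s x ≡ sortedLetter x
  monotone⇒≡sortedLetter s mono counts x = ≡-from-cuts λ c →
    ⇔.trans (subst (λ m → toℕ (s x) ℕ.< toℕ c ⇔ toℕ x ℕ.< m) (to (countOf⇔countBelow r) counts c)
               (count-down-closed (λ y → toℕ (s y) <? toℕ c) (λ x≤y → ℕP.≤-<-trans (mono x≤y)) x))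
            (⇔.sym (sortedLetter-< x c))
    where open LetterCounts s

toℕ-csuc-inject₁ : ∀ {n} (p : Fin n) → toℕ (csuc (inject₁ p)) ≡ suc (toℕ p)
toℕ-csuc-inject₁ {n} p with toℕ (inject₁ p) <? n
... | yes lt = trans (toℕ-fromℕ< (s≤s lt)) (cong suc (toℕ-inject₁ p))
... | no ¬lt = contradiction (FP.inject₁ℕ< p) ¬lt

punchIn-fromℕ : ∀ {n} (x : Fin n) → punchIn (fromℕ n) x ≡ inject₁ x
punchIn-fromℕ zero = refl
punchIn-fromℕ (suc x) = cong suc (punchIn-fromℕ x)

module TailRank {n : ℕ} (π : Permutation′ n) where

  tailRank : Fin n → Fin (suc n)
  tailRank x = Φ (extend π) (suc x)

  extend-suc : ∀ x → extend π ⟨$⟩ʳ suc x ≡ inject₁ (π ⟨$⟩ʳ x)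
  extend-suc x = trans (insert-punchIn zero (fromℕ n) π x) (punchIn-fromℕ (π ⟨$⟩ʳ x))

  toℕ-extend-tailRank : ∀ x → toℕ (extend π ⟨$⟩ʳ tailRank x) ≡ suc (toℕ (π ⟨$⟩ʳ x))
  toℕ-extend-tailRank x = begin
    toℕ (extend π ⟨$⟩ʳ tailRank x)               ≡⟨ cong toℕ (inverseʳ (extend π)) ⟩
    toℕ (csuc (extend π ⟨$⟩ʳ suc x))             ≡⟨ cong (toℕ ∘ csuc) (extend-suc x) ⟩
    toℕ (csuc (inject₁ (π ⟨$⟩ʳ x)))              ≡⟨ toℕ-csuc-inject₁ (π ⟨$⟩ʳ x) ⟩
    suc (toℕ (π ⟨$⟩ʳ x))                         ∎
    where open ≡-Reasoning

  tailRank≡zero : ∀ {x} → tailRank x ≡ zero → suc (toℕ (π ⟨$⟩ʳ x)) ≡ n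
  tailRank≡zero {x} e = begin
    suc (toℕ (π ⟨$⟩ʳ x))             ≡⟨ toℕ-extend-tailRank x ⟨
    toℕ (extend π ⟨$⟩ʳ tailRank x)   ≡⟨ cong (λ z → toℕ (extend π ⟨$⟩ʳ z)) e ⟩
    toℕ (fromℕ n)                    ≡⟨ toℕ-fromℕ n ⟩
    n                                ∎
    where open ≡-Reasoning

  tailRank≡suc : ∀ {x a} → tailRank x ≡ suc a → suc (toℕ (π ⟨$⟩ʳ x)) ≡ toℕ (π ⟨$⟩ʳ a)
  tailRank≡suc {x} {a} e = begin
    suc (toℕ (π ⟨$⟩ʳ x))             ≡⟨ toℕ-extend-tailRank x ⟨
    toℕ (extend π ⟨$⟩ʳ tailRank x)   ≡⟨ cong (λ z → toℕ (extend π ⟨$⟩ʳ z)) e ⟩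
    toℕ (extend π ⟨$⟩ʳ suc a)        ≡⟨ cong toℕ (extend-suc a) ⟩
    toℕ (inject₁ (π ⟨$⟩ʳ a))         ≡⟨ toℕ-inject₁ (π ⟨$⟩ʳ a) ⟩
    toℕ (π ⟨$⟩ʳ a)                   ∎
    where open ≡-Reasoning

  tailRank-injective : ∀ {x y} → tailRank x ≡ tailRank y → x ≡ y
  tailRank-injective {x} {y} e = ⟨$⟩ʳ-injective π (toℕ-injective (ℕP.suc-injective (begin
    suc (toℕ (π ⟨$⟩ʳ x))             ≡⟨ toℕ-extend-tailRank x ⟨
    toℕ (extend π ⟨$⟩ʳ tailRank x)   ≡⟨ cong (λ z → toℕ (extend π ⟨$⟩ʳ z)) e ⟩
    toℕ (extend π ⟨$⟩ʳ tailRank y)   ≡⟨ toℕ-extend-tailRank y ⟩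
    suc (toℕ (π ⟨$⟩ʳ y))             ∎)))
    where open ≡-Reasoning

drop-toList : ∀ {A : Set} {m} (u : Vec A m) (p : Fin m) →
  drop (toℕ p) (toList u) ≡ lookup u p ∷ drop (suc (toℕ p)) (toList u)
drop-toList (x ∷ xs) zero = refl
drop-toList (x ∷ xs) (suc p) = drop-toList xs p

module _ {k m : ℕ} (u : Vec (Fin k) m) where

  suffix-last : ∀ {p} → suc (toℕ p) ≡ m → suffix u p ≡ lookup u p ∷ []
  suffix-last {p} e = trans (drop-toList u p)
    (cong (lookup u p ∷_) (drop-all _ (toList u) (ℕP.≤-reflexive (trans (length-toList u) (sym e)))))

  suffix-next : ∀ {p q} → suc (toℕ p) ≡ toℕ q → suffix u p ≡ lookup u p ∷ suffix u q
  suffix-next {p} e = trans (drop-toList u p) (cong (λ i → lookup u p ∷ drop i (toList u)) e)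

<lex-asym : ∀ {k} {xs ys : List (Fin k)} → xs <lex ys → ¬ ys <lex xs
<lex-asym = <-asymmetric sym (resp₂ F._<_) FP.<-asym

<lex-head : ∀ {k} {c d : Fin k} {xs ys} → (c ∷ xs) <lex (d ∷ ys) → c F.≤ d
<lex-head (this c<d) = ℕP.<⇒≤ c<d
<lex-head (next refl _) = FP.≤-refl

module RankedSuffixes {k n : ℕ} (π : Permutation′ n) (u : Vec (Fin k) n) where
  open TailRank π

  rankedSuffix : Fin n → List (Fin k)
  rankedSuffix x = suffix u (π ⟨$⟩ʳ x)

  firstLetter : Fin n → Fin k
  firstLetter x = lookup u (π ⟨$⟩ʳ x)

  rankedSuffix-<lex-by-firstLetter : ∀ {x y} → firstLetter x F.< firstLetter y →
    rankedSuffix x <lex rankedSuffix y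
  rankedSuffix-<lex-by-firstLetter {x} {y} lt =
    subst₂ _<lex_ (sym (drop-toList u (π ⟨$⟩ʳ x))) (sym (drop-toList u (π ⟨$⟩ʳ y))) (this lt)

  rankedSuffix-<lex-by-tailRank : ∀ x y → firstLetter x ≡ firstLetter y → tailRank x F.< tailRank y →
    (∀ a b → tailRank x ≡ suc a → tailRank y ≡ suc b → a F.< b → rankedSuffix a <lex rankedSuffix b) →
    rankedSuffix x <lex rankedSuffix y
  rankedSuffix-<lex-by-tailRank x y same lt tails with tailRank x in ex | tailRank y in ey
  ... | _ | zero = contradiction lt ℕP.n≮0
  ... | zero | suc b = subst₂ _<lex_ (sym (suffix-last u (tailRank≡zero ex)))
    (sym (trans (suffix-next u (tailRank≡suc ey)) (cong (firstLetter y ∷_) (drop-toList u (π ⟨$⟩ʳ b)))))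
    (next same halt)
  ... | suc a | suc b = subst₂ _<lex_ (sym (suffix-next u (tailRank≡suc ex)))
    (sym (suffix-next u (tailRank≡suc ey))) (next same (tails a b refl refl (ℕ.s<s⁻¹ lt)))

module SuffixArrayProperties {k n : ℕ} (π : Permutation′ n) (u : Vec (Fin k) n)
                             (sa : IsSuffixArray u π) where
  open TailRank π
  open RankedSuffixes π u

  firstLetter-mono : ∀ {x y} → x F.≤ y → firstLetter x F.≤ firstLetter y
  firstLetter-mono x≤y with ≤⇒<∨≡ x≤y
  ... | inj₁ x<y = <lex-head (subst₂ _<lex_ (drop-toList u _) (drop-toList u _) (sa _ _ x<y))
  ... | inj₂ refl = FP.≤-refl

  tailRank-increasing : ∀ {x y} → x F.< y → firstLetter x ≡ firstLetter y → tailRank x F.< tailRank y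
  tailRank-increasing {x} {y} x<y same with FP.<-cmp (tailRank x) (tailRank y)
  ... | tri< lt _ _ = lt
  ... | tri≈ _ eq _ = contradiction (tailRank-injective eq) (FP.<⇒≢ x<y)
  ... | tri> _ _ gt = contradiction (sa x y x<y)
    (<lex-asym (rankedSuffix-<lex-by-tailRank y x (sym same) gt (λ a b _ _ → sa a b)))

module Characterisation {k n : ℕ} (r : Fin k → ℕ) (total≡n : total r ≡ n) (π : Permutation′ n) where
  open SortedWord r total≡n
  open TailRank π

  forcedWord : Vec (Fin k) n
  forcedWord = tabulate (sortedLetter ∘ (π ⟨$⟩ˡ_))

  firstLetter-forcedWord : ∀ x → lookup forcedWord (π ⟨$⟩ʳ x) ≡ sortedLetter x
  firstLetter-forcedWord x = trans (lookup∘tabulate _ (π ⟨$⟩ʳ x)) (cong sortedLetter (inverseˡ π))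

  forcedWord-content : HasContent r forcedWord
  forcedWord-content a = begin
    occ forcedWord a                                  ≡⟨ occ≡count forcedWord a ⟩
    count (λ p → lookup forcedWord p FP.≟ a)          ≡⟨ count-permute _ π ⟩
    count (λ x → lookup forcedWord (π ⟨$⟩ʳ x) FP.≟ a) ≡⟨ count-cong _ (λ x → sortedLetter x FP.≟ a)
                                                           (λ x → mk⇔ (trans (sym (firstLetter-forcedWord x)))
                                                                      (trans (firstLetter-forcedWord x))) ⟩
    count (λ x → sortedLetter x FP.≟ a)               ≡⟨ count-sortedLetter a ⟩
    r a                                               ∎
    where open ≡-Reasoning

  module _ {w : Vec (Fin k) n} (content : HasContent r w) (sa : IsSuffixArray w π) where
    open RankedSuffixes π w
    open SuffixArrayProperties π w sa

    firstLetter≡sortedLetter : ∀ x → firstLetter x ≡ sortedLetter x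
    firstLetter≡sortedLetter = monotone⇒≡sortedLetter firstLetter firstLetter-mono λ a → begin
      count (λ x → firstLetter x FP.≟ a)    ≡⟨ count-permute (λ p → lookup w p FP.≟ a) π ⟨
      count (λ p → lookup w p FP.≟ a)       ≡⟨ occ≡count w a ⟨
      occ w a                               ≡⟨ content a ⟩
      r a                                   ∎
      where open ≡-Reasoning

    ≡forcedWord : w ≡ forcedWord
    ≡forcedWord = begin
      w                                     ≡⟨ tabulate∘lookup w ⟨
      tabulate (lookup w)                   ≡⟨ tabulate-cong (λ p → trans (cong (lookup w) (sym (inverseʳ π)))
                                                                          (firstLetter≡sortedLetter (π ⟨$⟩ˡ p))) ⟩
      forcedWord                            ∎
      where open ≡-Reasoning

    descentsAllowed : DescentsAllowed r π
    descentsAllowed zero _ = 0≡prefixSum r (firstLetter zero)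
    descentsAllowed (suc a) descent = sortedLetter (suc a) ,
      sortedLetter-changes⇒boundary step λ same → ℕP.<-asym descent
        (tailRank-increasing (ℕP.≤-reflexive (sym step))
          (trans (firstLetter≡sortedLetter (inject₁ a)) (trans same (sym (firstLetter≡sortedLetter (suc a))))))
      where
      step : toℕ (suc a) ≡ suc (toℕ (inject₁ a))
      step = cong suc (sym (toℕ-inject₁ a))

  module _ (allowed : DescentsAllowed r π) where
    open RankedSuffixes π forcedWord

    tailRank-step : ∀ {a b} → toℕ b ≡ suc (toℕ a) → sortedLetter a ≡ sortedLetter b →
      tailRank a F.< tailRank b
    tailRank-step {a} {suc b} step same =
      FP.≤∧≢⇒< (ℕP.≮⇒≥ no-descent) (FP.<⇒≢ (ℕP.≤-reflexive (sym step)) ∘ tailRank-injective)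
      where
      a≡inject₁b : a ≡ inject₁ b
      a≡inject₁b = toℕ-injective (trans (ℕP.suc-injective (sym step)) (sym (toℕ-inject₁ b)))
      no-descent : ¬ tailRank (suc b) F.< tailRank a
      no-descent descent with allowed (suc b) (subst (λ z → tailRank (suc b) F.< tailRank z) a≡inject₁b descent)
      ... | j , boundary = boundary⇒sortedLetter-changes (inject₁ j) step boundary same

    tailRank-increasing-in-block : ∀ {i j} → i F.< j → sortedLetter i ≡ sortedLetter j → tailRank i F.< tailRank j
    tailRank-increasing-in-block {i} {j} i<j same = ≺-from-steps F._<_ FP.<-trans tailRank i<j
      λ step i≤a b≤j → tailRank-step step (FP.≤-antisym
        (sortedLetter-mono (ℕP.<⇒≤ (ℕP.≤-reflexive (sym step))))
        (FP.≤-trans (sortedLetter-mono b≤j) (FP.≤-trans (FP.≤-reflexive (sym same)) (sortedLetter-mono i≤a))))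

    rankedSuffix-ordered : ∀ m {i j} → toℕ (π ⟨$⟩ʳ i) + m ≡ n → i F.< j →
      rankedSuffix i <lex rankedSuffix j
    rankedSuffix-ordered zero {i} length _ =
      contradiction (trans (sym (ℕP.+-identityʳ _)) length) (ℕP.<⇒≢ (toℕ<n (π ⟨$⟩ʳ i)))
    rankedSuffix-ordered (suc m) {i} {j} length i<j with ≤⇒<∨≡ (sortedLetter-mono (ℕP.<⇒≤ i<j))
    ... | inj₁ lt = rankedSuffix-<lex-by-firstLetter
      (subst₂ F._<_ (sym (firstLetter-forcedWord i)) (sym (firstLetter-forcedWord j)) lt)
    ... | inj₂ same = rankedSuffix-<lex-by-tailRank i j
      (trans (firstLetter-forcedWord i) (trans same (sym (firstLetter-forcedWord j))))
      (tailRank-increasing-in-block i<j same)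
      (λ a b tail _ a<b → rankedSuffix-ordered m (tail-length tail) a<b)
      where
      tail-length : ∀ {a} → tailRank i ≡ suc a → toℕ (π ⟨$⟩ʳ a) + m ≡ n
      tail-length tail = trans (cong (_+ m) (sym (tailRank≡suc tail))) (trans (sym (ℕP.+-suc _ m)) length)

    forcedWord-suffixArray : IsSuffixArray forcedWord π
    forcedWord-suffixArray i j =
      rankedSuffix-ordered (n ∸ toℕ (π ⟨$⟩ʳ i)) (ℕP.m+[n∸m]≡n (ℕP.<⇒≤ (toℕ<n (π ⟨$⟩ʳ i))))

mainTheorem6 : ∀ {k n : ℕ} (r : Fin k → ℕ) → total r ≡ n → (π : Permutation′ n) →
    ((∃ λ (w : Vec (Fin k) n) → HasContent r w × IsSuffixArray w π) ⇔ DescentsAllowed r π)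
    × (∀ (w₁ w₂ : Vec (Fin k) n) → HasContent r w₁ → IsSuffixArray w₁ π →
         HasContent r w₂ → IsSuffixArray w₂ π → w₁ ≡ w₂)
mainTheorem6 r total≡n π =
  mk⇔ (λ (_ , content , sa) → descentsAllowed content sa)
      (λ allowed → forcedWord , forcedWord-content , forcedWord-suffixArray allowed) ,
  λ _ _ content₁ sa₁ content₂ sa₂ → trans (≡forcedWord content₁ sa₁) (sym (≡forcedWord content₂ sa₂))
  where open Characterisation r total≡n π
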